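{- Let $k,q$ be positive integers such that every divisor of $q$ other than $1$ is greater than $k$. Then for every two vertices $(i_1,j_1),(i_2,j_2)$ (as in the context) with $i_1\neq i_2$, there are positions $a,b$ in the sequence $\mathbf{s}$ with $\mathbf{s}_a=(i_1,j_1)$, $\mathbf{s}_b=(i_2,j_2)$ and $|a-b|\leq k$.
   Context: Vertices are pairs $(i,j)$ with $i\in\{0,\ldots,2k\}$ taken modulo $2k+1$ and $j\in\{0,\ldots,q-1\}$ taken modulo $q$. For $d\in\{0,\ldots,q-1\}$ let $c_d=\gcd((2k+1)d,q)$ (with $\gcd(0,q)=q$) and $t_d=\frac{(2k+1)q}{c_d}$. For $j\in\{0,\ldots,c_d-1\}$ let $\mathbf{c}_j^d$ be the sequence $(0,j),(1,j+d),(2,j+2d),\ldots,(t_d-1,j+(t_d-1)d)$, and let $\mathbf{s}_j^d$ be $\mathbf{c}_j^d$ followed by its first $k$ terms $(0,j),(1,j+d),\ldots,(k-1,j+(k-1)d)$. The sequence $\mathbf{s}$ is the concatenation $\mathbf{s}_0^0,\ldots,\mathbf{s}_{c_0-1}^0,\mathbf{s}_0^1,\ldots,\mathbf{s}_{c_1-1}^1,\ldots,\mathbf{s}_0^{q-1},\ldots,\mathbf{s}_{c_{q-1}-1}^{q-1}$. -}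

module Defs where

open import Data.Nat using (ℕ; zero; suc; _+_; _*_; _/_; _%_)
open import Data.Nat.GCD using (gcd)
open import Data.Product using (_×_; _,_)
open import Data.List using (List; map; upTo; take; _++_; concatMap)

-- Vertices are represented by pairs (i , j) of naturals with i < 2k+1, j < q
-- (canonical representatives of Z_{2k+1} × Z_q).
Vertex : Set
Vertex = ℕ × ℕ

-- n / c, with the convention that division by 0 yields 0 (never used when q ≥ 1).
divOr0 : ℕ → ℕ → ℕ
divOr0 n zero    = 0
divOr0 n (suc c) = n / suc c

-- n mod c, with the convention n mod 0 = n (never used when q ≥ 1).
modOr0 : ℕ → ℕ → ℕ
modOr0 n zero    = n
modOr0 n (suc c) = n % suc c

module Seq (k q : ℕ) where
  m : ℕ
  m = suc (2 * k)

  -- c_d = gcd((2k+1)d, q); note gcd 0 q = q in the library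
  c : ℕ → ℕ
  c d = gcd (m * d) q

  t : ℕ → ℕ
  t d = divOr0 (m * q) (c d)

  term : ℕ → ℕ → ℕ → Vertex
  term d j r = (r % suc (2 * k) , modOr0 (j + r * d) q)

  cseq : ℕ → ℕ → List Vertex
  cseq d j = map (term d j) (upTo (t d))

  sseq : ℕ → ℕ → List Vertex
  sseq d j = cseq d j ++ take k (cseq d j)

  s : List Vertex
  s = concatMap (λ d → concatMap (λ j → sseq d j) (upTo (c d))) (upTo q)

-- On the cycle
-- Z_M two distinct points are at distance δ ∈ [1,k] in one direction, say
-- i₂ ≡ i₁ + δ.  Since every nontrivial divisor of q exceeds k, δ is invertible
-- modulo q, so there is a slope d < q with j₁ + dδ ≡ j₂ (mod q).  Every vertex
-- lies on one of the diagonals c^d_j (j < c_d), say (i₁,j₁) is term r of c^d_j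
-- with r < t_d; by periodicity term r+δ of the block s^d_j is (i₂,j₂), and that
-- block is a contiguous piece of s.  Hence the two vertices sit δ ≤ k apart in s.
module Submission where

open import Defs
open import Data.Nat using (ℕ; zero; suc; pred; _+_; _*_; _∸_; _<_; _≤_; _≥_; ∣_-_∣;
  _%_; _/_; NonZero; ≢-nonZero; ≢-nonZero⁻¹; >-nonZero; s≤s; _<?_; _≤?_; _≟_)
open import Data.Nat.Properties
open import Data.Nat.DivMod
open import Data.Nat.Divisibility using (_∣_; ∣⇒≤)
open import Data.Nat.GCD using (gcd; gcd-GCD; gcd[m,n]∣m; gcd[m,n]∣n; gcd[m,n]≢0; module Bézout)
open import Data.Nat.Tactic.RingSolver using (solve-∀)
open import Data.Fin using (Fin; toℕ) renaming (zero to fzero; suc to fsuc)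
open import Data.Product using (Σ; ∃; ∃₂; _×_; _,_; proj₁; proj₂)
open import Data.Sum using (_⊎_; inj₁; inj₂; swap)
open import Data.Empty using (⊥-elim)
open import Data.Maybe using (Maybe; just; nothing)
open import Data.List using (List; []; _∷_; _++_; length; lookup; upTo; applyUpTo; take; concatMap)
open import Data.List.Properties using (concatMap-++; length-applyUpTo; map-upTo)
open import Data.List.Membership.Propositional using (_∈_)
open import Data.List.Membership.Propositional.Properties using (∈-∃++; ∈-upTo⁺)
open import Relation.Binary using (tri<; tri≈; tri>; IsEquivalence; Setoid)
open import Relation.Binary.PropositionalEquality
open import Relation.Nullary using (yes; no)
import Relation.Binary.Reasoning.Setoid as SetoidReasoning

-- Positions in lists, and lists occurring as contiguous blocks of others.
module _ {A : Set} where

  infixl 9 _!_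

  -- xs ! n is the entry of xs at position n, if any.  Unlike lookup it takes
  -- positions as plain naturals, so offsets can be added freely.
  _!_ : List A → ℕ → Maybe A
  []       ! n     = nothing
  (x ∷ xs) ! zero  = just x
  (x ∷ xs) ! suc n = xs ! n

  !⇒lookup : ∀ (xs : List A) n {x} → xs ! n ≡ just x →
             Σ (Fin (length xs)) λ a → toℕ a ≡ n × lookup xs a ≡ x
  !⇒lookup (y ∷ xs) zero    refl = fzero , refl , refl
  !⇒lookup (y ∷ xs) (suc n) hit with !⇒lookup xs n hit
  ... | a , a≡n , found = fsuc a , cong suc a≡n , found

  !-++ˡ : ∀ xs ys n {x} → xs ! n ≡ just x → (xs ++ ys) ! n ≡ just x
  !-++ˡ (y ∷ xs) ys zero    hit = hit
  !-++ˡ (y ∷ xs) ys (suc n) hit = !-++ˡ xs ys n hit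

  !-++ʳ : ∀ xs ys n → (xs ++ ys) ! (length xs + n) ≡ ys ! n
  !-++ʳ []       ys n = refl
  !-++ʳ (x ∷ xs) ys n = !-++ʳ xs ys n

  !-take : ∀ k xs n {x} → n < k → xs ! n ≡ just x → take k xs ! n ≡ just x
  !-take (suc k) (y ∷ xs) zero    _         hit = hit
  !-take (suc k) (y ∷ xs) (suc n) (s≤s n<k) hit = !-take k xs n n<k hit

  !-applyUpTo : ∀ (f : ℕ → A) {n p} → p < n → applyUpTo f n ! p ≡ just (f p)
  !-applyUpTo f {suc n} {zero}  _         = refl
  !-applyUpTo f {suc n} {suc p} (s≤s p<n) = !-applyUpTo (λ i → f (suc i)) p<n

  record Block (ys xs : List A) : Set where
    constructor block
    field
      offset : ℕ
      embed  : ∀ n {x} → ys ! n ≡ just x → xs ! (offset + n) ≡ just x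

  block-trans : ∀ {xs ys zs} → Block xs ys → Block ys zs → Block xs zs
  block-trans {zs = zs} (block o embed) (block o′ embed′) = block (o′ + o) λ n {x} hit →
    subst (λ p → zs ! p ≡ just x) (sym (+-assoc o′ o n)) (embed′ (o + n) (embed n hit))

  block-concatMap : ∀ {B : Set} (f : B → List A) {b bs} → b ∈ bs → Block (f b) (concatMap f bs)
  block-concatMap f b∈bs with ∈-∃++ b∈bs
  ... | before , after , refl = block (length (concatMap f before)) λ n {x} hit →
    begin
      concatMap f (before ++ _ ∷ after) ! (length (concatMap f before) + n)
        ≡⟨ cong (_! (length (concatMap f before) + n)) (concatMap-++ f before (_ ∷ after)) ⟩
      (concatMap f before ++ f _ ++ concatMap f after) ! (length (concatMap f before) + n)
        ≡⟨ !-++ʳ (concatMap f before) _ n ⟩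
      (f _ ++ concatMap f after) ! n
        ≡⟨ !-++ˡ (f _) _ n hit ⟩
      just x
    ∎
    where open ≡-Reasoning

  block-entries : ∀ {ys xs} → Block ys xs → ∀ p δ {x y} →
                  ys ! p ≡ just x → ys ! (p + δ) ≡ just y →
                  Σ (Fin (length xs)) λ a → Σ (Fin (length xs)) λ b →
                    lookup xs a ≡ x × lookup xs b ≡ y × ∣ toℕ a - toℕ b ∣ ≡ δ
  block-entries {xs = xs} (block o embed) p δ hit₁ hit₂
    with !⇒lookup xs (o + p) (embed p hit₁) | !⇒lookup xs (o + (p + δ)) (embed (p + δ) hit₂)
  ... | a , a≡ , found₁ | b , b≡ , found₂ = a , b , found₁ , found₂ ,
    (begin
      ∣ toℕ a - toℕ b ∣          ≡⟨ cong₂ ∣_-_∣ a≡ (trans b≡ (sym (+-assoc o p δ))) ⟩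
      ∣ o + p - o + p + δ ∣      ≡⟨ ∣m-m+n∣≡n (o + p) δ ⟩
      δ                          ∎)
    where open ≡-Reasoning

-- Congruence modulo a positive n, as a setoid on ℕ with its arithmetic.
module Congruence (n : ℕ) .{{_ : NonZero n}} where

  infix 4 _≈_
  infixl 6 _⊖_

  record _≈_ (a b : ℕ) : Set where
    constructor mk
    field residue : a % n ≡ b % n
  open _≈_ public

  ≈-isEquivalence : IsEquivalence _≈_
  ≈-isEquivalence = record
    { refl  = mk refl
    ; sym   = λ (mk e) → mk (sym e)
    ; trans = λ (mk e) (mk e′) → mk (trans e e′)
    }

  ≈-setoid : Setoid _ _
  ≈-setoid = record { isEquivalence = ≈-isEquivalence }

  module ≈-Reasoning = SetoidReasoning ≈-setoid

  open IsEquivalence ≈-isEquivalence public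
    using () renaming (refl to ≈-refl; sym to ≈-sym; trans to ≈-trans)

  ≡⇒≈ : ∀ {a b} → a ≡ b → a ≈ b
  ≡⇒≈ refl = ≈-refl

  +-cong : ∀ {a b c d} → a ≈ b → c ≈ d → a + c ≈ b + d
  +-cong {a} {b} {c} {d} (mk e) (mk e′) = mk (begin
    (a + c) % n             ≡⟨ %-distribˡ-+ a c n ⟩
    (a % n + c % n) % n     ≡⟨ cong₂ (λ x y → (x + y) % n) e e′ ⟩
    (b % n + d % n) % n     ≡⟨ %-distribˡ-+ b d n ⟨
    (b + d) % n             ∎)
    where open ≡-Reasoning

  *-cong : ∀ {a b c d} → a ≈ b → c ≈ d → a * c ≈ b * d
  *-cong {a} {b} {c} {d} (mk e) (mk e′) = mk (begin
    (a * c) % n             ≡⟨ %-distribˡ-* a c n ⟩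
    (a % n * (c % n)) % n   ≡⟨ cong₂ (λ x y → (x * y) % n) e e′ ⟩
    (b % n * (d % n)) % n   ≡⟨ %-distribˡ-* b d n ⟨
    (b * d) % n             ∎)
    where open ≡-Reasoning

  %-≈ : ∀ a → a % n ≈ a
  %-≈ a = mk (m%n%n≡m%n a n)

  +-multiple : ∀ a m → a + m * n ≈ a
  +-multiple a m = mk ([m+kn]%n≡m%n a m n)

  canonical : ∀ {a b} → a ≈ b → b < n → a % n ≡ b
  canonical (mk e) b<n = trans e (m<n⇒m%n≡m b<n)

  -- Subtraction modulo n, realised without leaving ℕ.
  _⊖_ : ℕ → ℕ → ℕ
  a ⊖ b = a + pred n * b

  ⊖-cancel : ∀ a b → a ⊖ b + b ≈ a
  ⊖-cancel a b = ≈-trans (≡⇒≈ rearrange) (+-multiple a b)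
    where
    shift : ∀ a p b → a + p * b + b ≡ a + b * suc p
    shift = solve-∀
    rearrange : a + pred n * b + b ≡ a + b * n
    rearrange = begin
      a + pred n * b + b     ≡⟨ shift a (pred n) b ⟩
      a + b * suc (pred n)   ≡⟨ cong (λ z → a + b * z) (suc-pred n) ⟩
      a + b * n              ∎
      where open ≡-Reasoning

  ⊖-intro : ∀ {a b c} → a + b ≈ c → a ≈ c ⊖ b
  ⊖-intro {a} {b} {c} a+b≈c = begin
    a               ≈⟨ ⊖-cancel a b ⟨
    a ⊖ b + b       ≡⟨ swap-middle a (pred n * b) b ⟩
    a + b ⊖ b       ≈⟨ +-cong a+b≈c ≈-refl ⟩
    c ⊖ b           ∎
    where
    open ≈-Reasoning
    swap-middle : ∀ x y z → x + y + z ≡ x + z + y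
    swap-middle = solve-∀

  bézout : ∀ A → ∃ λ v → v * A ≈ gcd A n
  bézout A with Bézout.identity (gcd-GCD A n)
  ... | Bézout.+- x y g+yn≡xA = x , ≈-trans (≡⇒≈ (sym g+yn≡xA)) (+-multiple _ y)
  ... | Bézout.-+ x y g+xA≡yn = pred n * x ,
          ≈-trans (≡⇒≈ (*-assoc (pred n) x A)) (≈-sym (⊖-intro (≈-trans (≡⇒≈ g+xA≡yn) (+-multiple 0 y))))

  -- The multiples of a fixed A modulo n form the subgroup generated by
  -- G = gcd A n; A has additive order n / G.
  module Multiples (A : ℕ) where

    G : ℕ
    G = gcd A n

    instance
      G-nonZero : NonZero G
      G-nonZero = ≢-nonZero (gcd[m,n]≢0 A n (inj₂ (≢-nonZero⁻¹ n)))

    order : ℕ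
    order = n / G

    instance
      order-nonZero : NonZero order
      order-nonZero = >-nonZero (m≥n⇒m/n>0 (∣⇒≤ (gcd[m,n]∣n A n)))

    order-annihilates : A * order ≡ A / G * n
    order-annihilates = begin
      A * (n / G)              ≡⟨ cong (_* (n / G)) (m/n*n≡m (gcd[m,n]∣m A n)) ⟨
      A / G * G * (n / G)      ≡⟨ *-assoc (A / G) G (n / G) ⟩
      A / G * (G * (n / G))    ≡⟨ cong (A / G *_) (m*[n/m]≡n (gcd[m,n]∣n A n)) ⟩
      A / G * n                ∎
      where open ≡-Reasoning

    +-order : ∀ x → x + A * order ≈ x
    +-order x = ≈-trans (≡⇒≈ (cong (x +_) order-annihilates)) (+-multiple x (A / G))

    *-mod-order : ∀ x → A * (x % order) ≈ A * x
    *-mod-order x = ≈-sym (begin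
      A * x                                  ≡⟨ cong (A *_) (m≡m%n+[m/n]*n x order) ⟩
      A * (x % order + x / order * order)    ≡⟨ distribute A (x % order) (x / order) order ⟩
      A * (x % order) + x / order * (A * order)
        ≡⟨ cong (λ z → A * (x % order) + x / order * z) order-annihilates ⟩
      A * (x % order) + x / order * (A / G * n)
        ≡⟨ cong (A * (x % order) +_) (*-assoc (x / order) (A / G) n) ⟨
      A * (x % order) + x / order * (A / G) * n
        ≈⟨ +-multiple (A * (x % order)) (x / order * (A / G)) ⟩
      A * (x % order)                        ∎)
      where
      open ≈-Reasoning
      distribute : ∀ a y z l → a * (y + z * l) ≡ a * y + z * (a * l)
      distribute = solve-∀

    decompose : ∀ W → ∃₂ λ j u → j < G × u < order × j + A * u ≈ W
    decompose W = W % G , x % order , m%n<n W G , m%n<n x order , (begin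
      W % G + A * (x % order)          ≈⟨ +-cong ≈-refl (*-mod-order x) ⟩
      W % G + A * (v * (W / G))        ≡⟨ cong (W % G +_) (reassociate A v (W / G)) ⟩
      W % G + v * A * (W / G)          ≈⟨ +-cong ≈-refl (*-cong vA≈G ≈-refl) ⟩
      W % G + G * (W / G)              ≡⟨ cong (W % G +_) (*-comm G (W / G)) ⟩
      W % G + W / G * G                ≡⟨ m≡m%n+[m/n]*n W G ⟨
      W                                ∎)
      where
      v : ℕ
      v = proj₁ (bézout A)
      vA≈G : v * A ≈ G
      vA≈G = proj₂ (bézout A)
      x : ℕ
      x = v * (W / G)
      open ≈-Reasoning
      reassociate : ∀ a v w → a * (v * w) ≡ v * a * w
      reassociate = solve-∀

  solve-linear : ∀ δ → gcd δ n ≡ 1 → ∀ a b → ∃ λ d → d < n × a + d * δ ≈ b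
  solve-linear δ coprime a b = d , m%n<n (v * (b ⊖ a)) n , (begin
    a + d * δ                   ≈⟨ +-cong ≈-refl (*-cong (%-≈ _) ≈-refl) ⟩
    a + v * (b ⊖ a) * δ         ≡⟨ cong (a +_) (swap-factors v (b ⊖ a) δ) ⟩
    a + v * δ * (b ⊖ a)         ≈⟨ +-cong ≈-refl (*-cong (≈-trans vδ≈gcd (≡⇒≈ coprime)) ≈-refl) ⟩
    a + 1 * (b ⊖ a)             ≡⟨ trans (cong (a +_) (*-identityˡ _)) (+-comm a _) ⟩
    b ⊖ a + a                   ≈⟨ ⊖-cancel b a ⟩
    b                           ∎)
    where
    v : ℕ
    v = proj₁ (bézout δ)
    vδ≈gcd : v * δ ≈ gcd δ n
    vδ≈gcd = proj₂ (bézout δ)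
    d : ℕ
    d = (v * (b ⊖ a)) % n
    open ≈-Reasoning
    swap-factors : ∀ x y z → x * y * z ≡ x * z * y
    swap-factors = solve-∀

cyclic-gap : ∀ k {i i′} → i < i′ → i′ < suc (2 * k) →
             ∃ λ δ → 0 < δ × δ ≤ k ×
               ((i + δ) % suc (2 * k) ≡ i′ ⊎ (i′ + δ) % suc (2 * k) ≡ i)
cyclic-gap k {i} {i′} i<i′ i′<M with i′ ∸ i ≤? k
... | yes gap≤k = i′ ∸ i , m<n⇒0<n∸m i<i′ , gap≤k , inj₁ forward
  where
  forward : (i + (i′ ∸ i)) % suc (2 * k) ≡ i′
  forward = trans (cong (_% suc (2 * k)) (m+[n∸m]≡n (<⇒≤ i<i′))) (m<n⇒m%n≡m i′<M)
... | no gap≰k = (i + M) ∸ i′ , m<n⇒0<n∸m i′<i+M , back-gap≤k , inj₂ backward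
  where
  M : ℕ
  M = suc (2 * k)
  i′<i+M : i′ < i + M
  i′<i+M = <-≤-trans i′<M (m≤n+m M i)
  back-gap≤k : (i + M) ∸ i′ ≤ k
  back-gap≤k = begin
    (i + M) ∸ i′               ≡⟨ cong ((i + M) ∸_) (m+[n∸m]≡n (<⇒≤ i<i′)) ⟨
    (i + M) ∸ (i + (i′ ∸ i))   ≡⟨ [m+n]∸[m+o]≡n∸o i M (i′ ∸ i) ⟩
    M ∸ (i′ ∸ i)               ≤⟨ ∸-monoʳ-≤ M (≰⇒> gap≰k) ⟩
    M ∸ suc k                  ≡⟨ trans (m+n∸m≡n k (k + 0)) (+-identityʳ k) ⟩
    k                          ∎
    where open ≤-Reasoning
  backward : (i′ + ((i + M) ∸ i′)) % M ≡ i
  backward = begin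
    (i′ + ((i + M) ∸ i′)) % M  ≡⟨ cong (_% M) (m+[n∸m]≡n (<⇒≤ i′<i+M)) ⟩
    (i + M) % M                ≡⟨ [m+n]%n≡m%n i M ⟩
    i % M                      ≡⟨ m<n⇒m%n≡m (<-trans i<i′ i′<M) ⟩
    i                          ∎
    where open ≡-Reasoning

cyclic-distance : ∀ k {i₁ i₂} → i₁ < suc (2 * k) → i₂ < suc (2 * k) → i₁ ≢ i₂ →
                  ∃ λ δ → 0 < δ × δ ≤ k ×
                    ((i₁ + δ) % suc (2 * k) ≡ i₂ ⊎ (i₂ + δ) % suc (2 * k) ≡ i₁)
cyclic-distance k {i₁} {i₂} i₁<M i₂<M i₁≢i₂ with <-cmp i₁ i₂
... | tri< i₁<i₂ _ _ = cyclic-gap k i₁<i₂ i₂<M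
... | tri≈ _ i₁≡i₂ _ = ⊥-elim (i₁≢i₂ i₁≡i₂)
... | tri> _ _ i₂<i₁ with cyclic-gap k i₂<i₁ i₁<M
...   | δ , 0<δ , δ≤k , direction = δ , 0<δ , δ≤k , swap direction

small-coprime : ∀ {k q δ} → ((e : ℕ) → e ∣ q → e ≢ 1 → k < e) → 0 < δ → δ ≤ k → gcd δ q ≡ 1
small-coprime {k} {q} {δ} large-divisors 0<δ δ≤k with gcd δ q ≟ 1
... | yes gcd≡1 = gcd≡1
... | no  gcd≢1 = ⊥-elim (<⇒≱ (large-divisors _ (gcd[m,n]∣n δ q) gcd≢1)
                               (≤-trans (∣⇒≤ {{>-nonZero 0<δ}} (gcd[m,n]∣m δ q)) δ≤k))

divOr0-nonZero : ∀ x g .{{_ : NonZero g}} → divOr0 x g ≡ x / g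
divOr0-nonZero x (suc g) = refl

-- The diagonals c^d_j of Z_{2k+1} × Z_q and their place in s, for q = q′+1.
module Diagonals (k q′ : ℕ) where

  open Seq k (suc q′)

  Q M : ℕ
  Q = suc q′
  M = suc (2 * k)

  open Congruence Q

  term-shift : ∀ d j r δ {i₁ j₁ j₂} → term d j r ≡ (i₁ , j₁) → i₁ < M → j₂ < Q →
               j₁ + d * δ ≈ j₂ → term d j (r + δ) ≡ ((i₁ + δ) % M , j₂)
  term-shift d j r δ {i₁} {j₁} {j₂} refl i₁<M j₂<Q j₁+dδ≈j₂ = cong₂ _,_ first second
    where
    first : (r + δ) % M ≡ ((r % M) + δ) % M
    first = trans (%-distribˡ-+ r δ M) (sym (trans (%-distribˡ-+ (r % M) δ M)
                                                   (cong (λ z → (z + δ % M) % M) (m%n%n≡m%n r M))))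
    second : (j + (r + δ) * d) % Q ≡ j₂
    second = canonical (begin
      j + (r + δ) * d          ≡⟨ step j r δ d ⟩
      (j + r * d) + d * δ      ≈⟨ +-cong (≈-sym (%-≈ (j + r * d))) ≈-refl ⟩
      j₁ + d * δ               ≈⟨ j₁+dδ≈j₂ ⟩
      j₂                       ∎) j₂<Q
      where
      open ≈-Reasoning
      step : ∀ j r δ d → j + (r + δ) * d ≡ j + r * d + d * δ
      step = solve-∀

  module Diagonal (d : ℕ) where

    open Multiples (M * d) using (G-nonZero; order; order-nonZero; +-order; decompose)

    L : ℕ
    L = order

    t≡M*L : t d ≡ M * L
    t≡M*L = trans (divOr0-nonZero (M * Q) (c d)) (*-/-assoc M (gcd[m,n]∣n (M * d) Q))

    -- A period is longer than the k-term tail appended in s^d_j.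
    k<t : k < t d
    k<t = subst (k <_) (sym t≡M*L) (≤-trans (s≤s (m≤m+n k (k + 0))) (m≤m*n M L))

    term-periodic : ∀ j r → term d j (r + t d) ≡ term d j r
    term-periodic j r = trans (cong (λ z → term d j (r + z)) t≡M*L) (cong₂ _,_ first second)
      where
      first : (r + M * L) % M ≡ r % M
      first = trans (cong (λ z → (r + z) % M) (*-comm M L)) ([m+kn]%n≡m%n r L M)
      full-turn : ∀ j r m l d → j + (r + m * l) * d ≡ j + r * d + m * d * l
      full-turn = solve-∀
      second : (j + (r + M * L) * d) % Q ≡ (j + r * d) % Q
      second = residue (≈-trans (≡⇒≈ (full-turn j r M L d)) (+-order (j + r * d)))

    cseq-at : ∀ j r → r < t d → cseq d j ! r ≡ just (term d j r)
    cseq-at j r r<t rewrite map-upTo (term d j) (t d) = !-applyUpTo (term d j) r<t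

    sseq-at : ∀ j r → r < t d + k → sseq d j ! r ≡ just (term d j r)
    sseq-at j r r<t+k with r <? t d
    ... | yes r<t = !-++ˡ (cseq d j) _ r (cseq-at j r r<t)
    ... | no  r≮t = begin
      sseq d j ! r                                  ≡⟨ cong (sseq d j !_) r≡len+r′ ⟩
      sseq d j ! (length (cseq d j) + r′)           ≡⟨ !-++ʳ (cseq d j) _ r′ ⟩
      take k (cseq d j) ! r′                        ≡⟨ !-take k (cseq d j) r′ r′<k (cseq-at j r′ (<-trans r′<k k<t)) ⟩
      just (term d j r′)                            ≡⟨ cong just (term-periodic j r′) ⟨
      just (term d j (r′ + t d))                    ≡⟨ cong (λ z → just (term d j z)) (m∸n+n≡m t≤r) ⟩
      just (term d j r)                             ∎
      where
      open ≡-Reasoning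
      t≤r : t d ≤ r
      t≤r = ≮⇒≥ r≮t
      r′ : ℕ
      r′ = r ∸ t d
      r≡len+r′ : r ≡ length (cseq d j) + r′
      r≡len+r′ = trans (sym (m+[n∸m]≡n t≤r))
                       (cong (_+ r′) (sym (trans (cong length (map-upTo (term d j) (t d)))
                                                 (length-applyUpTo (term d j) (t d)))))
      r′<k : r′ < k
      r′<k = +-cancelˡ-< (t d) r′ k (subst (_< t d + k) (sym (m+[n∸m]≡n t≤r)) r<t+k)

    term-reaches : ∀ {i₁ j₁} j u → i₁ < M → j₁ < Q → j + M * d * u ≈ j₁ ⊖ i₁ * d →
                   term d j (i₁ + M * u) ≡ (i₁ , j₁)
    term-reaches {i₁} {j₁} j u i₁<M j₁<Q j+Mdu≈ = cong₂ _,_ first second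
      where
      first : (i₁ + M * u) % M ≡ i₁
      first = trans (cong (λ z → (i₁ + z) % M) (*-comm M u))
                    (trans ([m+kn]%n≡m%n i₁ u M) (m<n⇒m%n≡m i₁<M))
      split : ∀ j i m u d → j + (i + m * u) * d ≡ j + m * d * u + i * d
      split = solve-∀
      second : (j + (i₁ + M * u) * d) % Q ≡ j₁
      second = canonical (begin
        j + (i₁ + M * u) * d        ≡⟨ split j i₁ M u d ⟩
        j + M * d * u + i₁ * d      ≈⟨ +-cong j+Mdu≈ ≈-refl ⟩
        j₁ ⊖ i₁ * d + i₁ * d        ≈⟨ ⊖-cancel j₁ (i₁ * d) ⟩
        j₁                          ∎) j₁<Q
        where open ≈-Reasoning

    within-period : ∀ {i₁ u} → i₁ < M → u < L → i₁ + M * u < t d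
    within-period {i₁} {u} i₁<M u<L = subst (i₁ + M * u <_) (sym t≡M*L) (begin-strict
      i₁ + M * u      <⟨ +-monoˡ-< (M * u) i₁<M ⟩
      M + M * u       ≡⟨ *-suc M u ⟨
      M * suc u       ≤⟨ *-monoʳ-≤ M u<L ⟩
      M * L           ∎)
      where open ≤-Reasoning

    covers : ∀ {i₁ j₁} → i₁ < M → j₁ < Q →
             ∃₂ λ j r → j < c d × r < t d × term d j r ≡ (i₁ , j₁)
    covers {i₁} {j₁} i₁<M j₁<Q =
      let j , u , j<c , u<L , j+Mdu≈ = decompose (j₁ ⊖ i₁ * d)
      in  j , i₁ + M * u , j<c , within-period i₁<M u<L , term-reaches j u i₁<M j₁<Q j+Mdu≈

  sseq-block : ∀ {d j} → d < Q → j < c d → Block (sseq d j) s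
  sseq-block {d} d<Q j<c =
    block-trans (block-concatMap (sseq d) (∈-upTo⁺ j<c))
                (block-concatMap (λ d′ → concatMap (sseq d′) (upTo (c d′))) (∈-upTo⁺ d<Q))

  Close : Vertex → Vertex → Set
  Close x y = Σ (Fin (length s)) λ a → Σ (Fin (length s)) λ b →
              (lookup s a ≡ x) × (lookup s b ≡ y) × (∣ toℕ a - toℕ b ∣ ≤ k)

  close-sym : ∀ {x y} → Close x y → Close y x
  close-sym (a , b , at-a , at-b , a~b) = b , a , at-b , at-a , subst (_≤ k) (∣-∣-comm (toℕ a) (toℕ b)) a~b

  diagonal-close : ∀ {d δ i₁ j₁ j₂} → d < Q → δ ≤ k → i₁ < M → j₁ < Q → j₂ < Q →
                   j₁ + d * δ ≈ j₂ → Close (i₁ , j₁) ((i₁ + δ) % M , j₂)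
  diagonal-close {d} {δ} d<Q δ≤k i₁<M j₁<Q j₂<Q slope =
    let j , r , j<c , r<t , hit = Diagonal.covers d i₁<M j₁<Q
        a , b , at-a , at-b , a~b = block-entries (sseq-block d<Q j<c) r δ
          (trans (Diagonal.sseq-at d j r (<-≤-trans r<t (m≤m+n (t d) k))) (cong just hit))
          (trans (Diagonal.sseq-at d j (r + δ) (+-mono-<-≤ r<t δ≤k))
                 (cong just (term-shift d j r δ hit i₁<M j₂<Q slope)))
    in  a , b , at-a , at-b , subst (_≤ k) (sym a~b) δ≤k

  step-close : ∀ {δ i₁ j₁ j₂} → δ ≤ k → gcd δ Q ≡ 1 → i₁ < M → j₁ < Q → j₂ < Q →
               Close (i₁ , j₁) ((i₁ + δ) % M , j₂)
  step-close {δ} {i₁} {j₁} {j₂} δ≤k coprime i₁<M j₁<Q j₂<Q =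
    let d , d<Q , slope = solve-linear δ coprime j₁ j₂
    in  diagonal-close d<Q δ≤k i₁<M j₁<Q j₂<Q slope

lemma3 : (k q : ℕ) → k ≥ 1 → q ≥ 1 →
         ((e : ℕ) → e ∣ q → e ≢ 1 → k < e) →
         (i₁ j₁ i₂ j₂ : ℕ) → i₁ < suc (2 * k) → j₁ < q → i₂ < suc (2 * k) → j₂ < q →
         i₁ ≢ i₂ →
         Σ (Fin (length (Seq.s k q))) λ a → Σ (Fin (length (Seq.s k q))) λ b →
           (lookup (Seq.s k q) a ≡ (i₁ , j₁)) × (lookup (Seq.s k q) b ≡ (i₂ , j₂)) ×
           (∣ toℕ a - toℕ b ∣ ≤ k)
lemma3 k (suc q′) _ _ large-divisors i₁ j₁ i₂ j₂ i₁<M j₁<q i₂<M j₂<q i₁≢i₂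
  with cyclic-distance k i₁<M i₂<M i₁≢i₂
... | δ , 0<δ , δ≤k , inj₁ i₁+δ≡i₂ =
  subst (λ i → Close (i₁ , j₁) (i , j₂)) i₁+δ≡i₂
        (step-close δ≤k (small-coprime large-divisors 0<δ δ≤k) i₁<M j₁<q j₂<q)
  where open Diagonals k q′
... | δ , 0<δ , δ≤k , inj₂ i₂+δ≡i₁ =
  close-sym (subst (λ i → Close (i₂ , j₂) (i , j₁)) i₂+δ≡i₁
                   (step-close δ≤k (small-coprime large-divisors 0<δ δ≤k) i₂<M j₂<q j₁<q))
  where open Diagonals k q′
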